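{- Let $\tau$ be a finite unordered rooted tree. Then $\tau$ is self-nested if and only if, for every $0\le h_2<h_1\le\mathcal{H}(\tau)$, all the components of the vector $\rho_\tau(h_1,h_2)$ are equal. Moreover, a self-nested tree can be reconstructed from its height profile: if $\tau$ and $\tau'$ are self-nested trees with the same height profile, then $\tau$ and $\tau'$ are isomorphic.
   Context: Trees are finite unordered rooted trees, considered up to isomorphism. For a vertex $v$ of $\tau$, $\mathcal{C}_\tau(v)$ is its set of children and $\tau[v]$ the subtree rooted at $v$. Heights: $\mathcal{H}(v)=0$ for a leaf, $\mathcal{H}(v)=1+\max_{w\in\mathcal{C}_\tau(v)}\mathcal{H}(w)$ otherwise; $\mathcal{H}(\tau[v])=\mathcal{H}(v)$, $\mathcal{H}(\tau)$ is the height of the root. A tree $\tau$ is self-nested if any two subtrees $\tau[v],\tau[w]$ with $\mathcal{H}(v)=\mathcal{H}(w)$ are isomorphic. For a vertex $v$, $\gamma_h(v)=\#\{v'\in\mathcal{C}_\tau(v):\mathcal{H}(\tau[v'])=h\}$. With a fixed traversal order of vertices, for $0\le h_2<h_1\le\mathcal{H}(\tau)$, $\rho_\tau(h_1,h_2)$ is the vector $(\gamma_{h_2}(v):\mathcal{H}(\tau[v])=h_1)$ listed in that order. The height profile $\rho_\tau=[\rho_\tau(h_1,h_2)]_{0\le h_2<h_1\le\mathcal{H}(\tau)}$ is considered up to the equivalence: two arrays $A_1,A_2$ of vectors are equivalent if for each row $i$ there is a permutation $\sigma_i$ with $A_1(i,j)=\sigma_i(A_2(i,j))$ for all $j$. 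-}

module Defs where

open import Data.Nat using (ℕ; zero; suc; _⊔_; _≟_; _<_; _≤_)
open import Data.List using (List; []; _∷_; map; filter; length; upTo; _++_)
open import Data.List.Membership.Propositional using (_∈_)
open import Data.List.Relation.Binary.Permutation.Propositional using (_↭_)
open import Data.List.Relation.Binary.Pointwise using (Pointwise)
open import Data.Product using (_×_)
open import Relation.Binary.PropositionalEquality using (_≡_)

-- Finite unordered rooted trees: a vertex together with the list of its
-- children.  The order of the list is irrelevant up to isomorphism (_≅_).
data Tree : Set where
  node : List Tree → Tree

data _≅_ : Tree → Tree → Set where
  node : ∀ {cs ds es} → cs ↭ es → Pointwise _≅_ es ds → node cs ≅ node ds

mutual
  height : Tree → ℕ
  height (node [])       = 0
  height (node (c ∷ cs)) = suc (maxHeight (c ∷ cs))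

  maxHeight : List Tree → ℕ
  maxHeight []       = 0
  maxHeight (c ∷ cs) = height c ⊔ maxHeight cs

-- The subtrees τ[v] for all vertices v of τ, listed in a fixed traversal
-- order (preorder).  Vertices are identified with their positions here.
mutual
  subtrees : Tree → List Tree
  subtrees (node cs) = node cs ∷ subtreesList cs

  subtreesList : List Tree → List Tree
  subtreesList []       = []
  subtreesList (c ∷ cs) = subtrees c ++ subtreesList cs

SelfNested : Tree → Set
SelfNested τ = ∀ s t → s ∈ subtrees τ → t ∈ subtrees τ →
               height s ≡ height t → s ≅ t

gamma : ℕ → Tree → ℕ
gamma h (node cs) = length (filter (λ c → height c ≟ h) cs)

verticesAt : Tree → ℕ → List Tree
verticesAt τ h₁ = filter (λ v → height v ≟ h₁) (subtrees τ)

rho : Tree → ℕ → ℕ → List ℕ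
rho τ h₁ h₂ = map (gamma h₂) (verticesAt τ h₁)

AllEqual : List ℕ → Set
AllEqual xs = ∀ x y → x ∈ xs → y ∈ xs → x ≡ y

-- Row h₁ of the height profile, read vertex by vertex: for each vertex v of
-- height h₁ (in traversal order) the tuple (ρ(h₁,0)_v, …, ρ(h₁,h₁-1)_v)
-- = (γ_0(v), …, γ_{h₁-1}(v)).
profileRow : Tree → ℕ → List (List ℕ)
profileRow τ h₁ = map (λ v → map (λ h₂ → gamma h₂ v) (upTo h₁)) (verticesAt τ h₁)

-- Equivalence of height profiles: same shape (same height) and, for each
-- row h₁, one permutation σ_{h₁} of the vertices of height h₁ carrying every
-- column ρ_τ'(h₁,h₂) to ρ_τ(h₁,h₂) simultaneously; equivalently the lists of
-- per-vertex column tuples of row h₁ are permutations of each other.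
SameProfile : Tree → Tree → Set
SameProfile τ τ' = height τ ≡ height τ' ×
  (∀ h₁ → 1 ≤ h₁ → h₁ ≤ height τ → profileRow τ h₁ ↭ profileRow τ' h₁)

-- A tree is rebuilt, vertex by vertex from the leaves up, from the numbers γ_h(v): two
-- vertices of equal height whose children have the same height counts, and whose
-- children of equal height are isomorphic, are isomorphic (match children of equal
-- height greedily).  In a tree whose ρ-vectors are constant, two vertices of equal
-- height have the same counts, so by induction on height they are isomorphic.  If τ
-- and τ′ have equivalent profiles, every vertex of τ has a twin of the same height in
-- τ′ with the same counts; when τ′ is self-nested all vertices of that height in τ′
-- share those counts, and the same induction yields τ ≅ τ′.
module Submission where

open import Defs
open import Data.Nat using (ℕ; suc; _⊔_; _+_; _≟_; _<_; _≤_; _<?_; z≤n; s≤s)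
open import Data.Nat.Properties
  using (≤-refl; ≤-trans; <-≤-trans; ≤-<-trans; <⇒≢; ≮⇒≥; n≤1+n; m≤m⊔n; m≤n⊔m;
         +-cancelˡ-≡; ⊔-0-isCommutativeMonoid)
open import Data.Product using (_×_; ∃; _,_; proj₁; proj₂)
open import Data.Sum using (inj₁; inj₂)
open import Data.List using (List; []; _∷_; [_]; _++_; map; filter; length; foldr; upTo)
open import Data.List.Properties using (filter-accept; filter-none; filter-++; length-++; ∷-injective)
open import Data.List.Membership.Propositional using (_∈_)
open import Data.List.Membership.Propositional.Properties
  using (∈-map⁺; ∈-map⁻; ∈-filter⁺; ∈-filter⁻; ∈-++⁺ˡ; ∈-++⁺ʳ; ∈-++⁻; ∈-∃++; ∈-upTo⁺)
open import Data.List.Relation.Unary.All as All using (All; []; _∷_)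
open import Data.List.Relation.Unary.Any using (here; there)
open import Data.List.Relation.Binary.Permutation.Propositional as ↭
  using (_↭_; prep; swap; ↭-refl; ↭-sym; ↭-trans; ↭⇒↭ₛ)
open import Data.List.Relation.Binary.Permutation.Propositional.Properties
  using (↭-length; map⁺; filter-↭; ∈-resp-↭; shift)
open import Data.List.Relation.Binary.Permutation.Setoid.Properties using (foldr-commMonoid)
open import Data.List.Relation.Binary.Pointwise as Pointwise using (Pointwise; []; _∷_; Pointwise-length)
open import Function using (_∘_)
open import Function.Bundles using (_⇔_; mk⇔)
open import Relation.Binary.Core using (Rel)
open import Relation.Binary.PropositionalEquality
  using (_≡_; refl; sym; trans; cong; cong₂; subst; setoid; module ≡-Reasoning)
open import Relation.Nullary using (yes; no)

private
  variable
    h : ℕ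
    c d s t τ τ′ : Tree
    cs ds ds′ : List Tree

pointwise-↭-commute : ∀ {a ℓ} {A : Set a} {R : Rel A ℓ} {xs ys ys′ : List A} →
  Pointwise R xs ys → ys ↭ ys′ → ∃ λ xs′ → xs ↭ xs′ × Pointwise R xs′ ys′
pointwise-↭-commute xs∼ys ↭.refl = _ , ↭-refl , xs∼ys
pointwise-↭-commute (r ∷ rs) (prep _ p) with pointwise-↭-commute rs p
... | _ , q , rs′ = _ , prep _ q , r ∷ rs′
pointwise-↭-commute (r ∷ r′ ∷ rs) (swap _ _ p) with pointwise-↭-commute rs p
... | _ , q , rs′ = _ , swap _ _ q , r′ ∷ r ∷ rs′
pointwise-↭-commute rs (↭.trans p q) with pointwise-↭-commute rs p
... | _ , p′ , rs′ with pointwise-↭-commute rs′ q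
...   | _ , q′ , rs″ = _ , ↭-trans p′ q′ , rs″

∈-∃↭ : ∀ {a} {A : Set a} {x : A} {xs : List A} → x ∈ xs → ∃ λ ys → xs ↭ x ∷ ys
∈-∃↭ x∈xs with ∈-∃++ x∈xs
... | ys , zs , refl = ys ++ zs , shift _ ys zs

map-≡⇒≡-on : ∀ {a b} {A : Set a} {B : Set b} {f g : A → B} {x : A} {xs : List A} →
  map f xs ≡ map g xs → x ∈ xs → f x ≡ g x
map-≡⇒≡-on {xs = _ ∷ _} eq (here refl) = proj₁ (∷-injective eq)
map-≡⇒≡-on {xs = _ ∷ _} eq (there x∈) = map-≡⇒≡-on (proj₂ (∷-injective eq)) x∈

maxHeight≡foldr : ∀ cs → maxHeight cs ≡ foldr _⊔_ 0 (map height cs)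
maxHeight≡foldr []       = refl
maxHeight≡foldr (c ∷ cs) = cong (height c ⊔_) (maxHeight≡foldr cs)

maxHeight-↭ : cs ↭ ds → maxHeight cs ≡ maxHeight ds
maxHeight-↭ {cs} {ds} p = begin
  maxHeight cs                  ≡⟨ maxHeight≡foldr cs ⟩
  foldr _⊔_ 0 (map height cs)   ≡⟨ foldr-commMonoid (setoid ℕ) ⊔-0-isCommutativeMonoid (↭⇒↭ₛ (map⁺ height p)) ⟩
  foldr _⊔_ 0 (map height ds)   ≡⟨ maxHeight≡foldr ds ⟨
  maxHeight ds                  ∎
  where open ≡-Reasoning

height-↭ : cs ↭ ds → height (node cs) ≡ height (node ds)
height-↭ {[]}    {[]}    _ = refl
height-↭ {_ ∷ _} {_ ∷ _} p = cong suc (maxHeight-↭ p)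
height-↭ {[]}    {_ ∷ _} p with () ← ↭-length p
height-↭ {_ ∷ _} {[]}    p with () ← ↭-length p

mutual
  height-≅ : s ≅ t → height s ≡ height t
  height-≅ (node p rs) = trans (height-↭ p) (height-pointwise rs)

  height-pointwise : Pointwise _≅_ cs ds → height (node cs) ≡ height (node ds)
  height-pointwise []       = refl
  height-pointwise (r ∷ rs) = cong suc (maxHeight-pointwise (r ∷ rs))

  maxHeight-pointwise : Pointwise _≅_ cs ds → maxHeight cs ≡ maxHeight ds
  maxHeight-pointwise []       = refl
  maxHeight-pointwise (r ∷ rs) = cong₂ _⊔_ (height-≅ r) (maxHeight-pointwise rs)

child-height-≤ : c ∈ cs → height c ≤ maxHeight cs
child-height-≤ {cs = c ∷ cs} (here refl) = m≤m⊔n (height c) (maxHeight cs)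
child-height-≤ {cs = c ∷ cs} (there c∈)  = ≤-trans (child-height-≤ c∈) (m≤n⊔m (height c) (maxHeight cs))

child-height-< : c ∈ cs → height c < height (node cs)
child-height-< {cs = _ ∷ _} c∈ = s≤s (child-height-≤ c∈)

∈-subtreesList⁺ : c ∈ cs → s ∈ subtrees c → s ∈ subtreesList cs
∈-subtreesList⁺ {cs = c ∷ cs} (here refl) s∈ = ∈-++⁺ˡ s∈
∈-subtreesList⁺ {cs = c ∷ cs} (there c∈)  s∈ = ∈-++⁺ʳ (subtrees c) (∈-subtreesList⁺ c∈ s∈)

subtrees-self : ∀ τ → τ ∈ subtrees τ
subtrees-self (node cs) = here refl

mutual
  subtrees-trans : ∀ τ → t ∈ subtrees τ → s ∈ subtrees t → s ∈ subtrees τ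
  subtrees-trans (node cs) (here refl) s∈ = s∈
  subtrees-trans (node cs) (there t∈)  s∈ = there (subtreesList-trans cs t∈ s∈)

  subtreesList-trans : ∀ cs → t ∈ subtreesList cs → s ∈ subtrees t → s ∈ subtreesList cs
  subtreesList-trans (c ∷ cs) t∈ s∈ with ∈-++⁻ (subtrees c) t∈
  ... | inj₁ t∈c  = ∈-++⁺ˡ (subtrees-trans c t∈c s∈)
  ... | inj₂ t∈cs = ∈-++⁺ʳ (subtrees c) (subtreesList-trans cs t∈cs s∈)

child∈subtrees : c ∈ cs → node cs ∈ subtrees τ → c ∈ subtrees τ
child∈subtrees {c} {τ = τ} c∈ n∈ = subtrees-trans τ n∈ (there (∈-subtreesList⁺ c∈ (subtrees-self c)))

mutual
  subtree-height-≤ : ∀ τ → s ∈ subtrees τ → height s ≤ height τ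
  subtree-height-≤ (node cs)       (here refl) = ≤-refl
  subtree-height-≤ (node (c ∷ cs)) (there s∈)  = ≤-trans (subtreesList-height-≤ (c ∷ cs) s∈) (n≤1+n _)

  subtreesList-height-≤ : ∀ cs → s ∈ subtreesList cs → height s ≤ maxHeight cs
  subtreesList-height-≤ (c ∷ cs) s∈ with ∈-++⁻ (subtrees c) s∈
  ... | inj₁ s∈c  = ≤-trans (subtree-height-≤ c s∈c) (m≤m⊔n (height c) (maxHeight cs))
  ... | inj₂ s∈cs = ≤-trans (subtreesList-height-≤ cs s∈cs) (m≤n⊔m (height c) (maxHeight cs))

gamma-↭ : cs ↭ ds → gamma h (node cs) ≡ gamma h (node ds)
gamma-↭ {h = h} p = ↭-length (filter-↭ (λ c → height c ≟ h) p)

gamma-heights : Pointwise (λ c d → height c ≡ height d) cs ds → gamma h (node cs) ≡ gamma h (node ds)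
gamma-heights {h = h} hs = Pointwise-length
  (Pointwise.filter⁺ (λ c → height c ≟ h) (λ d → height d ≟ h) (λ e → trans (sym e)) trans hs)

gamma-≅ : s ≅ t → gamma h s ≡ gamma h t
gamma-≅ (node p rs) = trans (gamma-↭ p) (gamma-heights (Pointwise.map height-≅ rs))

gamma-++ : ∀ cs ds → gamma h (node (cs ++ ds)) ≡ gamma h (node cs) + gamma h (node ds)
gamma-++ {h} cs ds = trans (cong length (filter-++ (λ c → height c ≟ h) cs ds)) (length-++ (filter _ cs))

gamma-accept : height c ≡ h → gamma h (node (c ∷ cs)) ≡ suc (gamma h (node cs))
gamma-accept {h = h} e = cong length (filter-accept (λ c → height c ≟ h) e)

gamma-∷-cancel : height c ≡ height d →
  gamma h (node (c ∷ cs)) ≡ gamma h (node (d ∷ ds)) → gamma h (node cs) ≡ gamma h (node ds)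
gamma-∷-cancel {c} {d} {h} {cs} {ds} e eq = +-cancelˡ-≡ (gamma h (node [ c ])) _ _ (begin
  gamma h (node [ c ]) + gamma h (node cs)  ≡⟨ gamma-++ [ c ] cs ⟨
  gamma h (node (c ∷ cs))                   ≡⟨ eq ⟩
  gamma h (node (d ∷ ds))                   ≡⟨ gamma-++ [ d ] ds ⟩
  gamma h (node [ d ]) + gamma h (node ds)  ≡⟨ cong (_+ gamma h (node ds)) (gamma-heights (sym e ∷ [])) ⟩
  gamma h (node [ c ]) + gamma h (node ds)  ∎)
  where open ≡-Reasoning

gamma-pos : 0 < gamma h (node ds) → ∃ λ d → d ∈ ds × height d ≡ h
gamma-pos {h} {ds} pos with filter (λ c → height c ≟ h) ds in eq
... | d ∷ _ = d , ∈-filter⁻ (λ c → height c ≟ h) (subst (d ∈_) (sym eq) (here refl))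

gamma-above : height t ≤ h → gamma h t ≡ 0
gamma-above {node cs} {h} t≤h = cong length (filter-none (λ c → height c ≟ h)
  (All.tabulate λ c∈ e → <⇒≢ (<-≤-trans (child-height-< c∈) t≤h) e))

partner-of-head : (∀ h → gamma h (node (c ∷ cs)) ≡ gamma h (node ds)) → ∃ λ d → d ∈ ds × height d ≡ height c
partner-of-head {c} {cs} same =
  gamma-pos (subst (0 <_) (trans (sym (gamma-accept {c} {cs = cs} refl)) (same (height c))) (s≤s z≤n))

≅-node-↭ʳ : node cs ≅ node ds → ds ↭ ds′ → node cs ≅ node ds′
≅-node-↭ʳ (node p rs) q with pointwise-↭-commute rs q
... | _ , p′ , rs′ = node (↭-trans p p′) rs′

≅-node-∷ : c ≅ d → node cs ≅ node ds → node (c ∷ cs) ≅ node (d ∷ ds)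
≅-node-∷ r (node p rs) = node (prep _ p) (r ∷ rs)

≅-node-by-matching : ∀ cs ds → (∀ h → gamma h (node cs) ≡ gamma h (node ds)) →
  (∀ {c d} → c ∈ cs → d ∈ ds → height c ≡ height d → c ≅ d) → node cs ≅ node ds
≅-node-by-matching [] [] _ _ = node ↭-refl []
≅-node-by-matching [] (d ∷ ds) same _ with _ , () , _ ← partner-of-head {d} {ds} {[]} (λ h → sym (same h))
≅-node-by-matching (c ∷ cs) ds same iso
  with d , d∈ , d-height ← partner-of-head same
  with rest , ds↭ ← ∈-∃↭ d∈
  = ≅-node-↭ʳ (≅-node-∷ (iso (here refl) d∈ (sym d-height)) (≅-node-by-matching cs rest same′ iso′))
              (↭-sym ds↭)
  where
  same′ : ∀ h → gamma h (node cs) ≡ gamma h (node rest)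
  same′ h = gamma-∷-cancel (sym d-height) (trans (same h) (gamma-↭ ds↭))
  iso′ : ∀ {c′ d′} → c′ ∈ cs → d′ ∈ rest → height c′ ≡ height d′ → c′ ≅ d′
  iso′ c′∈ d′∈ = iso (there c′∈) (∈-resp-↭ (↭-sym ds↭) (there d′∈))

module _ {τ τ′ : Tree}
  (gamma-agrees : ∀ {s t h} → s ∈ subtrees τ → t ∈ subtrees τ′ →
                  height s ≡ height t → h < height s → gamma h s ≡ gamma h t)
  where

  mutual
    ≅-if-gamma-agrees : ∀ s → s ∈ subtrees τ → ∀ {t} → t ∈ subtrees τ′ → height s ≡ height t → s ≅ t
    ≅-if-gamma-agrees (node cs) s∈ {node ds} t∈ eq = ≅-node-by-matching cs ds same-gammas iso-children
      where
      same-gammas : ∀ h → gamma h (node cs) ≡ gamma h (node ds)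
      same-gammas h with h <? height (node cs)
      ... | yes h< = gamma-agrees s∈ t∈ eq h<
      ... | no h≮  = trans (gamma-above (≮⇒≥ h≮)) (sym (gamma-above (subst (_≤ h) eq (≮⇒≥ h≮))))
      iso-children : ∀ {c d} → c ∈ cs → d ∈ ds → height c ≡ height d → c ≅ d
      iso-children c∈ d∈ =
        All.lookup (≅-if-gamma-agrees-children cs (λ c∈ → child∈subtrees c∈ s∈)) c∈ (child∈subtrees d∈ t∈)

    ≅-if-gamma-agrees-children : ∀ cs → (∀ {c} → c ∈ cs → c ∈ subtrees τ) →
      All (λ c → ∀ {t} → t ∈ subtrees τ′ → height c ≡ height t → c ≅ t) cs
    ≅-if-gamma-agrees-children []       _   = []
    ≅-if-gamma-agrees-children (c ∷ cs) cs⊆ =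
      ≅-if-gamma-agrees c (cs⊆ (here refl)) ∷ ≅-if-gamma-agrees-children cs (cs⊆ ∘ there)

∈-verticesAt⁺ : s ∈ subtrees τ → s ∈ verticesAt τ (height s)
∈-verticesAt⁺ {s} s∈ = ∈-filter⁺ (λ v → height v ≟ height s) s∈ refl

∈-verticesAt⁻ : ∀ {h₁} → s ∈ verticesAt τ h₁ → s ∈ subtrees τ × height s ≡ h₁
∈-verticesAt⁻ {h₁ = h₁} = ∈-filter⁻ (λ v → height v ≟ h₁)

gamma∈rho : s ∈ subtrees τ → gamma h s ∈ rho τ (height s) h
gamma∈rho {h = h} s∈ = ∈-map⁺ (gamma h) (∈-verticesAt⁺ s∈)

selfNested⇒rho-allEqual : SelfNested τ → ∀ h₁ h₂ → AllEqual (rho τ h₁ h₂)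
selfNested⇒rho-allEqual {τ} sn h₁ h₂ _ _ x∈ y∈
  with v , v∈ , refl ← ∈-map⁻ (gamma h₂) x∈
  with w , w∈ , refl ← ∈-map⁻ (gamma h₂) y∈
  with v∈τ , v-height ← ∈-verticesAt⁻ v∈
  with w∈τ , w-height ← ∈-verticesAt⁻ w∈
  = gamma-≅ (sn v w v∈τ w∈τ (trans v-height (sym w-height)))

rho-allEqual⇒selfNested : (∀ h₁ h₂ → h₂ < h₁ → h₁ ≤ height τ → AllEqual (rho τ h₁ h₂)) → SelfNested τ
rho-allEqual⇒selfNested {τ} allEqual s t s∈ t∈ eq = ≅-if-gamma-agrees gamma-agrees s s∈ t∈ eq
  where
  gamma-agrees : ∀ {s t h} → s ∈ subtrees τ → t ∈ subtrees τ →
                 height s ≡ height t → h < height s → gamma h s ≡ gamma h t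
  gamma-agrees {s} {t} {h} s∈ t∈ eq h< = allEqual (height s) h h< (subtree-height-≤ τ s∈) _ _
    (gamma∈rho s∈) (subst (λ k → gamma h t ∈ rho τ k h) (sym eq) (gamma∈rho t∈))

-- profileRow τ h₁ is definitionally map (gammasBelow h₁) (verticesAt τ h₁).
gammasBelow : ℕ → Tree → List ℕ
gammasBelow h₁ v = map (λ h₂ → gamma h₂ v) (upTo h₁)

sameProfile⇒twin : SameProfile τ τ′ → s ∈ subtrees τ → 1 ≤ height s →
  ∃ λ w → w ∈ subtrees τ′ × height w ≡ height s × (∀ {h} → h < height s → gamma h s ≡ gamma h w)
sameProfile⇒twin {τ} {τ′} {s} (_ , rows) s∈ 1≤height
  with w , w∈ , same-row ← ∈-map⁻ (gammasBelow (height s))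
         (∈-resp-↭ (rows (height s) 1≤height (subtree-height-≤ τ s∈))
                   (∈-map⁺ (gammasBelow (height s)) (∈-verticesAt⁺ s∈)))
  with w∈τ′ , w-height ← ∈-verticesAt⁻ w∈
  = w , w∈τ′ , w-height , λ h< → map-≡⇒≡-on same-row (∈-upTo⁺ h<)

sameProfile⇒≅ : SelfNested τ′ → SameProfile τ τ′ → τ ≅ τ′
sameProfile⇒≅ {τ′} {τ} sn′ profile =
  ≅-if-gamma-agrees gamma-agrees τ (subtrees-self τ) (subtrees-self τ′) (proj₁ profile)
  where
  gamma-agrees : ∀ {s t h} → s ∈ subtrees τ → t ∈ subtrees τ′ →
                 height s ≡ height t → h < height s → gamma h s ≡ gamma h t
  gamma-agrees {s} {t} s∈ t∈ eq h<
    with w , w∈ , w-height , gammas-agree ← sameProfile⇒twin profile s∈ (≤-<-trans z≤n h<)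
    = trans (gammas-agree h<) (gamma-≅ (sn′ w t w∈ t∈ (trans w-height eq)))

proposition3 :
    (∀ (τ : Tree) → SelfNested τ ⇔
        (∀ h₁ h₂ → h₂ < h₁ → h₁ ≤ height τ → AllEqual (rho τ h₁ h₂)))
    × (∀ (τ τ′ : Tree) → SelfNested τ → SelfNested τ′ → SameProfile τ τ′ → τ ≅ τ′)
proposition3 =
    (λ τ → mk⇔ (λ sn h₁ h₂ _ _ → selfNested⇒rho-allEqual sn h₁ h₂) rho-allEqual⇒selfNested)
  , λ τ τ′ _ sn′ → sameProfile⇒≅ sn′
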